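{- Let $G$ be a finite connected undirected unweighted graph with node set $V$. The binary relation $\preceq$ on $V$ defined by $u\preceq x$ if and only if $e(u)=d(u,x)+e(x)$ is a partial order. Moreover, the set $U^{\preceq}$ of maximal elements of this partial order (the nodes $x$ such that $x\preceq y$ implies $y=x$) is the unique tight upper certificate of $G$ of minimum size.
   Context: $d$ is shortest-path distance, $e(u)=\max_v d(u,v)$. For $U\subseteq V$, $e^U(u)=\min_{x\in U}(d(u,x)+e(x))$; $U$ is a tight upper certificate of $G$ if $e^U(u)=e(u)$ for all $u\in V$. -}

module Defs where

open import Data.Nat using (ℕ; zero; suc; _+_; _≤_; _⊔_)
open import Data.Fin using (Fin)
open import Data.Fin.Subset using (Subset; _∈_; ∣_∣)
open import Data.List using (List; foldr; map; allFin)
open import Data.Product using (Σ; ∃; _×_)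
open import Data.Empty using (⊥)
open import Relation.Nullary using (¬_)
open import Relation.Binary.PropositionalEquality using (_≡_)
open import Relation.Binary.Structures using (IsPartialOrder)
open import Function.Bundles using (_⇔_)

record Graph : Set₁ where
  field
    n     : ℕ
    Adj   : Fin n → Fin n → Set
    sym   : ∀ {u v} → Adj u v → Adj v u
    irrefl : ∀ {u} → ¬ Adj u u

module _ (G : Graph) where
  open Graph G

  data Walk : Fin n → Fin n → Set where
    []  : ∀ {u} → Walk u u
    _∷_ : ∀ {u v w} → Adj u v → Walk v w → Walk u w

  walkLength : ∀ {u v} → Walk u v → ℕ
  walkLength []      = 0
  walkLength (_ ∷ p) = suc (walkLength p)

  Connected : Set
  Connected = ∀ u v → Walk u v

  IsShortestPathDist : (Fin n → Fin n → ℕ) → Set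
  IsShortestPathDist d =
    (∀ u v → Σ (Walk u v) λ p → walkLength p ≡ d u v) ×
    (∀ u v (p : Walk u v) → d u v ≤ walkLength p)

  module Ecc (d : Fin n → Fin n → ℕ) where

    ecc : Fin n → ℕ
    ecc u = foldr _⊔_ 0 (map (d u) (allFin n))

    _⪯_ : Fin n → Fin n → Set
    u ⪯ x = ecc u ≡ d u x + ecc x

    -- e^U(u) = min_{x ∈ U} (d(u,x) + e(x)) is equal to m
    -- (m is attained by some x ∈ U and is ≤ every value over U).
    eU≡ : Subset n → Fin n → ℕ → Set
    eU≡ U u m = (∃ λ x → x ∈ U × d u x + ecc x ≡ m) ×
                (∀ x → x ∈ U → m ≤ d u x + ecc x)

    TightUpperCertificate : Subset n → Set
    TightUpperCertificate U = ∀ u → eU≡ U u (ecc u)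

    IsMaximal : Fin n → Set
    IsMaximal x = ∀ y → x ⪯ y → y ≡ x

-- The triangle inequality gives e(u) ≤ d(u,x) + e(x) for every x, so u ⪯ x says that x is
-- an optimal choice in e^U(u) whenever x ∈ U; transitivity and antisymmetry of ⪯ follow
-- from the triangle inequality and d(u,x) = 0 ⇒ u = x. A strict step u ⪯ x, x ≠ u lowers
-- the eccentricity, so above every node lies a maximal one: the maximal nodes form a tight
-- certificate. Conversely a tight certificate U must contain every maximal x, because the
-- node of U realising e^U(x) = e(x) lies above x. Hence U^⪯ is contained in every tight
-- certificate, which makes it the unique one of minimum size.
module Submission where

open import Defs
open import Data.Nat using (ℕ; suc; _+_; _⊔_; _≤_; _<_; z≤n)
open import Data.Nat.Properties
open import Data.Nat.Induction using (<-wellFounded)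
open import Data.Fin using (Fin) renaming (_≟_ to _≟ᶠ_)
open import Data.Fin.Properties using (any?)
open import Data.Fin.Subset using (Subset; _∈_; _⊆_; ∣_∣)
open import Data.Fin.Subset.Properties using (_∈?_; ⊆-antisym; p⊆q⇒∣p∣≤∣q∣; p⊂q⇒∣p∣<∣q∣)
open import Data.List using (foldr; map; allFin)
open import Data.List.Properties using (foldr-preservesᵒ; foldr-preservesᵇ)
open import Data.List.Membership.Propositional using () renaming (_∈_ to _∈ˡ_)
open import Data.List.Membership.Propositional.Properties using (∈-map⁺; ∈-allFin)
open import Data.List.Relation.Unary.All as All using (All)
open import Data.List.Relation.Unary.All.Properties using (map⁺)
open import Data.List.Relation.Unary.Any as Any using ()
open import Data.Product using (Σ; ∃; _×_; _,_; proj₁; proj₂)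
open import Data.Sum using (_⊎_; inj₁; inj₂)
open import Induction.WellFounded using (Acc; acc)
open import Relation.Nullary using (yes; no; contradiction; ¬?)
open import Relation.Nullary.Decidable using (_×-dec_; decidable-stable)
open import Relation.Binary.PropositionalEquality
open import Relation.Binary.Structures using (IsPartialOrder)
open import Function.Bundles using (_⇔_; Equivalence)

p⊆q∧∣q∣≤∣p∣⇒q≡p : ∀ {n} {p q : Subset n} → p ⊆ q → ∣ q ∣ ≤ ∣ p ∣ → q ≡ p
p⊆q∧∣q∣≤∣p∣⇒q≡p {p = p} p⊆q ∣q∣≤∣p∣ = ⊆-antisym q⊆p p⊆q
  where
  q⊆p : _ ⊆ p
  q⊆p {x} x∈q with x ∈? p
  ... | yes x∈p = x∈p
  ... | no  x∉p = contradiction ∣q∣≤∣p∣ (<⇒≱ (p⊂q⇒∣p∣<∣q∣ (p⊆q , x , x∈q , x∉p)))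

≤-foldr-⊔ : ∀ {k xs} → k ∈ˡ xs → k ≤ foldr _⊔_ 0 xs
≤-foldr-⊔ {k} k∈xs = foldr-preservesᵒ ⊔-preserves-≤ 0 _ (inj₂ (Any.map ≤-reflexive k∈xs))
  where
  ⊔-preserves-≤ : ∀ x y → k ≤ x ⊎ k ≤ y → k ≤ x ⊔ y
  ⊔-preserves-≤ x y (inj₁ k≤x) = m≤n⇒m≤n⊔o y k≤x
  ⊔-preserves-≤ x y (inj₂ k≤y) = m≤n⇒m≤o⊔n x k≤y

foldr-⊔-≤ : ∀ {m xs} → All (_≤ m) xs → foldr _⊔_ 0 xs ≤ m
foldr-⊔-≤ = foldr-preservesᵇ ⊔-lub z≤n

module _ (G : Graph) where
  open Graph G using (n)

  infixr 5 _++ʷ_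

  _++ʷ_ : ∀ {u v w} → Walk G u v → Walk G v w → Walk G u w
  []      ++ʷ q = q
  (a ∷ p) ++ʷ q = a ∷ (p ++ʷ q)

  length-++ʷ : ∀ {u v w} (p : Walk G u v) (q : Walk G v w) →
               walkLength G (p ++ʷ q) ≡ walkLength G p + walkLength G q
  length-++ʷ []      q = refl
  length-++ʷ (a ∷ p) q = cong suc (length-++ʷ p q)

  module ShortestPathDist (d : Fin n → Fin n → ℕ) (isSPD : IsShortestPathDist G d) where

    private
      shortest : ∀ u v → Σ (Walk G u v) λ p → walkLength G p ≡ d u v
      shortest = proj₁ isSPD

      minimal : ∀ u v (p : Walk G u v) → d u v ≤ walkLength G p
      minimal = proj₂ isSPD

    d-refl : ∀ u → d u u ≡ 0
    d-refl u = n≤0⇒n≡0 (minimal u u [])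

    d≡0⇒≡ : ∀ {u v} → d u v ≡ 0 → u ≡ v
    d≡0⇒≡ {u} {v} duv≡0 with shortest u v
    ... | []    , _     = refl
    ... | _ ∷ _ , len≡d = contradiction (trans len≡d duv≡0) λ ()

    d-triangle : ∀ u v w → d u w ≤ d u v + d v w
    d-triangle u v w with shortest u v | shortest v w
    ... | p , ∣p∣≡duv | q , ∣q∣≡dvw =
      subst (d u w ≤_) (trans (length-++ʷ p q) (cong₂ _+_ ∣p∣≡duv ∣q∣≡dvw)) (minimal u w (p ++ʷ q))

  module Eccentricity
    (d : Fin n → Fin n → ℕ)
    (d-refl : ∀ u → d u u ≡ 0)
    (d≡0⇒≡ : ∀ {u v} → d u v ≡ 0 → u ≡ v)
    (d-triangle : ∀ u v w → d u w ≤ d u v + d v w)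
    where

    open Ecc G d

    d≤ecc : ∀ u v → d u v ≤ ecc u
    d≤ecc u v = ≤-foldr-⊔ (∈-map⁺ (d u) (∈-allFin v))

    ecc≤d+ecc : ∀ u x → ecc u ≤ d u x + ecc x
    ecc≤d+ecc u x = foldr-⊔-≤ (map⁺ {xs = allFin n} (All.tabulate λ {v} _ → begin
      d u v             ≤⟨ d-triangle u x v ⟩
      d u x + d x v     ≤⟨ +-monoʳ-≤ (d u x) (d≤ecc x v) ⟩
      d u x + ecc x     ∎))
      where open ≤-Reasoning

    ⪯-reflexive : ∀ {u x} → u ≡ x → u ⪯ x
    ⪯-reflexive {u} refl = cong (_+ ecc u) (sym (d-refl u))

    ⪯-trans : ∀ {u x y} → u ⪯ x → x ⪯ y → u ⪯ y
    ⪯-trans {u} {x} {y} u⪯x x⪯y = ≤-antisym (ecc≤d+ecc u y) (begin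
      d u y + ecc y          ≤⟨ +-monoˡ-≤ (ecc y) (d-triangle u x y) ⟩
      d u x + d x y + ecc y  ≡⟨ +-assoc (d u x) (d x y) (ecc y) ⟩
      d u x + (d x y + ecc y) ≡⟨ cong (d u x +_) x⪯y ⟨
      d u x + ecc x          ≡⟨ u⪯x ⟨
      ecc u                  ∎)
      where open ≤-Reasoning

    ⪯-antisym : ∀ {u x} → u ⪯ x → x ⪯ u → u ≡ x
    ⪯-antisym {u} {x} u⪯x x⪯u = d≡0⇒≡ (m+n≡0⇒m≡0 (d u x) round-trip≡0)
      where
      round-trip≡0 : d u x + d x u ≡ 0
      round-trip≡0 = +-cancelʳ-≡ (ecc u) (d u x + d x u) 0 (begin
        d u x + d x u + ecc u   ≡⟨ +-assoc (d u x) (d x u) (ecc u) ⟩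
        d u x + (d x u + ecc u) ≡⟨ cong (d u x +_) x⪯u ⟨
        d u x + ecc x           ≡⟨ u⪯x ⟨
        ecc u                   ∎)
        where open ≡-Reasoning

    ⪯-isPartialOrder : IsPartialOrder _≡_ _⪯_
    ⪯-isPartialOrder = record
      { isPreorder = record
        { isEquivalence = isEquivalence
        ; reflexive     = ⪯-reflexive
        ; trans         = ⪯-trans
        }
      ; antisym = ⪯-antisym
      }

    ⪯∧≢⇒ecc> : ∀ {x y} → x ⪯ y → y ≢ x → ecc y < ecc x
    ⪯∧≢⇒ecc> {x} {y} x⪯y y≢x =
      subst (ecc y <_) (sym x⪯y) (m<n+m (ecc y) (n≢0⇒n>0 (λ dxy≡0 → y≢x (sym (d≡0⇒≡ dxy≡0)))))

    maximal⊎⪯-strictly : ∀ x → IsMaximal x ⊎ ∃ λ y → x ⪯ y × y ≢ x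
    maximal⊎⪯-strictly x with any? (λ y → (ecc x ≟ d x y + ecc y) ×-dec ¬? (y ≟ᶠ x))
    ... | yes above = inj₂ above
    ... | no  ∄above = inj₁ λ y x⪯y → decidable-stable (y ≟ᶠ x) λ y≢x → ∄above (y , x⪯y , y≢x)

    maximal-above : ∀ x → ∃ λ z → IsMaximal z × x ⪯ z
    maximal-above x = go x (<-wellFounded (ecc x))
      where
      go : ∀ x → Acc _<_ (ecc x) → ∃ λ z → IsMaximal z × x ⪯ z
      go x (acc rs) with maximal⊎⪯-strictly x
      ... | inj₁ x-max = x , x-max , ⪯-reflexive refl
      ... | inj₂ (y , x⪯y , y≢x) with go y (rs (⪯∧≢⇒ecc> x⪯y y≢x))
      ...   | z , z-max , y⪯z = z , z-max , ⪯-trans x⪯y y⪯z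

    ⪯-covering⇒tight : ∀ {U} → (∀ u → ∃ λ x → x ∈ U × u ⪯ x) → TightUpperCertificate U
    ⪯-covering⇒tight covering u with covering u
    ... | x , x∈U , u⪯x = (x , x∈U , sym u⪯x) , λ y _ → ecc≤d+ecc u y

    tight⇒maximal∈ : ∀ {U x} → TightUpperCertificate U → IsMaximal x → x ∈ U
    tight⇒maximal∈ {x = x} tight x-max with proj₁ (tight x)
    ... | y , y∈U , x⪯y with x-max y (sym x⪯y)
    ... | refl = y∈U

proposition2 : (G : Graph) → Connected G →
    (d : Fin (Graph.n G) → Fin (Graph.n G) → ℕ) → IsShortestPathDist G d →
    IsPartialOrder _≡_ (Ecc._⪯_ G d) ×
    ((Umax : Subset (Graph.n G)) →
      (∀ x → (x ∈ Umax) ⇔ Ecc.IsMaximal G d x) →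
      Ecc.TightUpperCertificate G d Umax ×
      (∀ U → Ecc.TightUpperCertificate G d U → ∣ Umax ∣ ≤ ∣ U ∣) ×
      (∀ U → Ecc.TightUpperCertificate G d U → ∣ U ∣ ≤ ∣ Umax ∣ → U ≡ Umax))
proposition2 G _ d isSPD = ⪯-isPartialOrder , λ Umax Umax⇔maximal →
  let Umax⊆ : ∀ U → Ecc.TightUpperCertificate G d U → Umax ⊆ U
      Umax⊆ U tight x∈Umax = tight⇒maximal∈ tight (Equivalence.to (Umax⇔maximal _) x∈Umax)
  in  ⪯-covering⇒tight (λ u → let z , z-max , u⪯z = maximal-above u
                                in  z , Equivalence.from (Umax⇔maximal z) z-max , u⪯z)
    , (λ U tight → p⊆q⇒∣p∣≤∣q∣ (Umax⊆ U tight))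
    , (λ U tight → p⊆q∧∣q∣≤∣p∣⇒q≡p (Umax⊆ U tight))
  where
  open ShortestPathDist G d isSPD
  open Eccentricity G d d-refl d≡0⇒≡ d-triangle
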